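{- Let $G$ be a band. Then $\chi(G)\le\lceil\frac54\omega(G)\rceil$.
   Context: Graphs are finite and simple. For disjoint sets $X,Y$: $[X,Y]$ complete means every vertex of $X$ is adjacent to every vertex of $Y$; $[X,Y]$ empty means there is no edge between them. A pair $\{X,Y\}$ of disjoint sets is graded if any two vertices $x,x'\in X$ satisfy $N(x)\cap Y\subseteq N(x')\cap Y$ or $N(x')\cap Y\subseteq N(x)\cap Y$. A band is any graph whose vertex set can be partitioned into seven sets $Q_1,\ldots,Q_5,R_2,R_3$ such that: each of them is a clique; $[Q_5,Q_1\cup Q_4]$, $[R_2,Q_1\cup Q_2\cup Q_3]$, $[R_3,Q_2\cup Q_3\cup Q_4]$ and $[Q_2,Q_3]$ are complete; $[Q_1,Q_3\cup R_3\cup Q_4]$, $[Q_4,Q_1\cup Q_2\cup R_2]$ and $[Q_5,Q_2\cup R_2\cup Q_3\cup R_3]$ are empty; and the pairs $\{Q_1,Q_2\}$, $\{Q_3,Q_4\}$, $\{R_2,R_3\}$ are graded. $\chi$ is the chromatic number and $\omega$ the clique number. -}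

module Defs where

open import Data.Nat using (ℕ; _+_; _*_; _/_)
open import Data.Fin using (Fin)
open import Data.Fin.Subset using (Subset; _∈_; ∣_∣)
open import Data.Product using (Σ; _×_; ∃)
open import Data.Sum using (_⊎_)
open import Relation.Nullary using (¬_; Dec)
open import Relation.Binary.PropositionalEquality using (_≡_; _≢_)

record Graph (n : ℕ) : Set₁ where
  field
    Adj   : Fin n → Fin n → Set
    sym   : ∀ {u v} → Adj u v → Adj v u
    irrefl : ∀ {u} → ¬ Adj u u
    dec   : ∀ u v → Dec (Adj u v)
open Graph public

module _ {n : ℕ} (G : Graph n) where

  IsClique : Subset n → Set
  IsClique S = ∀ u v → u ∈ S → v ∈ S → u ≢ v → Adj G u v

  IsCliqueNumber : ℕ → Set
  IsCliqueNumber w =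
    (Σ (Subset n) λ S → IsClique S × ∣ S ∣ ≡ w) ×
    (∀ S → IsClique S → ∣ S ∣ Data.Nat.≤ w)

  Colorable : ℕ → Set
  Colorable k = Σ (Fin n → Fin k) λ c → ∀ u v → Adj G u v → c u ≢ c v

data Part : Set where
  Q1 Q2 Q3 Q4 Q5 R2 R3 : Part

module _ {n : ℕ} (G : Graph n) (part : Fin n → Part) where

  PartClique : Part → Set
  PartClique a = ∀ u v → part u ≡ a → part v ≡ a → u ≢ v → Adj G u v

  Complete : Part → Part → Set
  Complete a b = ∀ u v → part u ≡ a → part v ≡ b → Adj G u v

  Empty : Part → Part → Set
  Empty a b = ∀ u v → part u ≡ a → part v ≡ b → ¬ Adj G u v

  NbhdIncl : Part → Fin n → Fin n → Set
  NbhdIncl b x x' = ∀ y → part y ≡ b → Adj G x y → Adj G x' y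

  Graded : Part → Part → Set
  Graded a b = ∀ x x' → part x ≡ a → part x' ≡ a →
               NbhdIncl b x x' ⊎ NbhdIncl b x' x

  record IsBandPartition : Set where
    field
      cliques : ∀ a → PartClique a
      c-Q5-Q1 : Complete Q5 Q1
      c-Q5-Q4 : Complete Q5 Q4
      c-R2-Q1 : Complete R2 Q1
      c-R2-Q2 : Complete R2 Q2
      c-R2-Q3 : Complete R2 Q3
      c-R3-Q2 : Complete R3 Q2
      c-R3-Q3 : Complete R3 Q3
      c-R3-Q4 : Complete R3 Q4
      c-Q2-Q3 : Complete Q2 Q3
      e-Q1-Q3 : Empty Q1 Q3
      e-Q1-R3 : Empty Q1 R3
      e-Q1-Q4 : Empty Q1 Q4
      e-Q4-Q2 : Empty Q4 Q2
      e-Q4-R2 : Empty Q4 R2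
      e-Q5-Q2 : Empty Q5 Q2
      e-Q5-R2 : Empty Q5 R2
      e-Q5-Q3 : Empty Q5 Q3
      e-Q5-R3 : Empty Q5 R3
      g-Q1-Q2 : Graded Q1 Q2
      g-Q3-Q4 : Graded Q3 Q4
      g-R2-R3 : Graded R2 R3

-- G is a band: its vertex set can be partitioned into seven (possibly empty)
-- sets Q1,...,Q5,R2,R3 as in the definition (the partition is the labelling `part`).
IsBand : {n : ℕ} → Graph n → Set
IsBand G = ∃ λ part → IsBandPartition G part

ceil5/4 : ℕ → ℕ
ceil5/4 w = (5 * w + 3) / 4

-- The parts of a band lie in five zones around a cycle,
--   Q5 | Q1 | Q2,R2 | Q3,R3 | Q4,
-- every edge joins equal or consecutive zones, and two consecutive zones form
-- a window.  We colour an induced subgraph U carrying a load p, a bound p i on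
-- the cliques of U inside window i, with Φ p = max (max p) ⌈Σ p / 4⌉ colours,
-- by induction on |U|.  Either U has a vertex that is simplicial inside a
-- window (it has fewer than Φ p neighbours and is coloured last), or U has a
-- stable set S whose removal lowers four loads by one and keeps the fifth
-- below Φ p; then Φ drops and S takes the spare colour.  The uniform load ω
-- has Φ = ⌈5ω/4⌉.
module Submission where

open import Defs renaming (sym to adj-sym; dec to adj?)
open import Level using (0ℓ)
open import Data.Nat using (ℕ; zero; suc; _+_; _*_; _∸_; _/_; _%_; _≤_; _<_; _⊔_; _⊓_; z≤n; s≤s)
import Data.Nat as ℕ
open import Data.Nat.Properties hiding (_≟_)
open import Data.Nat.DivMod using (m≡m%n+[m/n]*n; m%n<n; m<n*o⇒m/o<n)
open import Data.Nat.Induction using (<-wellFounded)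
open import Induction.WellFounded using (Acc; acc)
open import Algebra.Properties.CommutativeSemigroup +-commutativeSemigroup using (interchange)
open import Data.Fin using (Fin; zero; suc; _≟_; toℕ; fromℕ<)
open import Data.Fin.Patterns using (0F; 1F; 2F; 3F; 4F)
import Data.Fin.Properties as Fin
open import Data.Fin.Properties using (any?; toℕ-fromℕ<)
open import Data.Fin.Subset using (Subset; _∈_; _∉_; _⊆_; _∪_; _∩_; _─_; _-_; ⁅_⁆; ∣_∣; ⊤; Nonempty; outside)
  renaming (⊥ to ∅)
open import Data.Fin.Subset.Properties
  using (_∈?_; nonempty?; ∈⊤; ⊥⊆; ∉⊥; ∣⊥∣≡0; x∈⁅x⁆; x∈⁅y⁆⇒x≡y; x∈p∪q⁻; x∈p∪q⁺; x∈p∩q⁺; x∈p∩q⁻;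
         q⊆p∪q; p⊂q⇒∣p∣<∣q∣;
         p─q⊆p; x∈p∧x∉q⇒x∈p─q; p∩q≢∅⇒∣p─q∣<∣p∣; x∈p⇒∣p-x∣<∣p∣; x∈p∧x≢y⇒x∈p-y)
open import Data.Vec using (_∷_; tabulate; here; there)
open import Data.Vec.Properties using (lookup∘tabulate; []=⇒lookup; lookup⇒[]=)
open import Data.List using (List; []; _∷_; allFin)
open import Data.List.Relation.Unary.Any using (here; there)
import Data.List.Relation.Unary.All as All
open import Data.List.Membership.Propositional using () renaming (_∈_ to _∈ₗ_)
open import Data.List.Membership.Propositional.Properties using (∈-allFin)
open import Data.Bool using (Bool; true; false; T; _∨_; not)
open import Data.Product using (Σ; Σ-syntax; ∃; _×_; _,_; proj₁; proj₂)
open import Data.Sum using (_⊎_; inj₁; inj₂; swap)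
open import Data.Empty using (⊥)
open import Data.Unit using (tt)
open import Function using (_∘_)
open import Relation.Unary using (Pred; Decidable)
open import Relation.Nullary using (¬_; Dec; yes; no; contradiction; does)
open import Relation.Nullary.Decidable
  using (⌊_⌋; True; toWitness; fromWitness; dec-true; map′; _×-dec_; _→-dec_; ¬?; decidable-stable; T?)
open import Relation.Binary.PropositionalEquality using (_≡_; _≢_; refl; sym; trans; cong; subst; module ≡-Reasoning)

∑ : ∀ {k} → (Fin k → ℕ) → ℕ
∑ {zero} f = 0
∑ {suc k} f = f zero + ∑ (f ∘ suc)

Max : ∀ {k} → (Fin k → ℕ) → ℕ
Max {zero} f = 0
Max {suc k} f = f zero ⊔ Max (f ∘ suc)

≤-Max : ∀ {k} (f : Fin k → ℕ) i → f i ≤ Max f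
≤-Max f zero = m≤m⊔n _ _
≤-Max f (suc i) = ≤-trans (≤-Max (f ∘ suc) i) (m≤n⊔m _ _)

Max-lub : ∀ {k} {f : Fin k → ℕ} {b} → (∀ i → f i ≤ b) → Max f ≤ b
Max-lub {zero} h = z≤n
Max-lub {suc k} h = ⊔-lub (h zero) (Max-lub (h ∘ suc))

∑-mono : ∀ {k} {f g : Fin k → ℕ} → (∀ i → f i ≤ g i) → ∑ f ≤ ∑ g
∑-mono {zero} h = z≤n
∑-mono {suc k} h = +-mono-≤ (h zero) (∑-mono (h ∘ suc))

∑-+ : ∀ {k} (f g : Fin k → ℕ) → ∑ (λ i → f i + g i) ≡ ∑ f + ∑ g
∑-+ {zero} f g = refl
∑-+ {suc k} f g = begin
  (f zero + g zero) + ∑ (λ i → f (suc i) + g (suc i)) ≡⟨ cong (f zero + g zero +_) (∑-+ (f ∘ suc) (g ∘ suc)) ⟩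
  (f zero + g zero) + (∑ (f ∘ suc) + ∑ (g ∘ suc))      ≡⟨ interchange (f zero) (g zero) _ _ ⟩
  (f zero + ∑ (f ∘ suc)) + (g zero + ∑ (g ∘ suc))      ∎
  where open ≡-Reasoning

∑-lower : ∀ {k} {f : Fin k → ℕ} {b} → (∀ i → b ≤ f i) → k * b ≤ ∑ f
∑-lower {zero} h = z≤n
∑-lower {suc k} h = +-mono-≤ (h zero) (∑-lower (h ∘ suc))

∑-upper : ∀ {k} {f : Fin k → ℕ} {b} → (∀ i → f i ≤ b) → ∑ f ≤ k * b
∑-upper {zero} h = z≤n
∑-upper {suc k} h = +-mono-≤ (h zero) (∑-upper (h ∘ suc))

⌈_/4⌉ : ℕ → ℕ
⌈ x /4⌉ = (x + 3) / 4

≤-4*⌈/4⌉ : ∀ x → x ≤ 4 * ⌈ x /4⌉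
≤-4*⌈/4⌉ x = +-cancelʳ-≤ 3 x (4 * q) (begin
  x + 3         ≡⟨ m≡m%n+[m/n]*n (x + 3) 4 ⟩
  r + q * 4     ≤⟨ +-mono-≤ (≤-pred (m%n<n (x + 3) 4)) (≤-reflexive (*-comm q 4)) ⟩
  3 + 4 * q     ≡⟨ +-comm 3 (4 * q) ⟩
  4 * q + 3     ∎)
  where
  open ≤-Reasoning
  q = ⌈ x /4⌉
  r = (x + 3) % 4

⌈/4⌉-least : ∀ {x g} → x ≤ 4 * g → ⌈ x /4⌉ ≤ g
⌈/4⌉-least {x} {g} x≤4g = ≤-pred (m<n*o⇒m/o<n (begin-strict
  x + 3         ≤⟨ +-monoˡ-≤ 3 x≤4g ⟩
  4 * g + 3     ≡⟨ +-comm (4 * g) 3 ⟩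
  3 + 4 * g     <⟨ n<1+n _ ⟩
  4 + 4 * g     ≡⟨ *-suc 4 g ⟨
  4 * suc g     ≡⟨ *-comm 4 (suc g) ⟩
  suc g * 4     ∎))
  where open ≤-Reasoning

Window : Set
Window = Fin 5

-- A load assigns a clique bound to every window.
Load : Set
Load = Window → ℕ

-- Some window other than a given one (to witness that a peeled set is nonempty).
another : Window → Window
another 0F = 1F
another _ = 0F

another-≢ : ∀ j → another j ≢ j
another-≢ 0F ()
another-≢ (suc j) ()

-- The potential of a load: the number of colours the induction promises.
Φ : Load → ℕ
Φ p = Max p ⊔ ⌈ ∑ p /4⌉

load≤Φ : ∀ p i → p i ≤ Φ p
load≤Φ p i = ≤-trans (≤-Max p i) (m≤m⊔n _ _)

∑≤4Φ : ∀ p → ∑ p ≤ 4 * Φ p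
∑≤4Φ p = ≤-trans (≤-4*⌈/4⌉ (∑ p)) (*-monoʳ-≤ 4 (m≤n⊔m (Max p) _))

Φ-least : ∀ {p g} → (∀ i → p i ≤ g) → ∑ p ≤ 4 * g → Φ p ≤ g
Φ-least each total = ⊔-lub (Max-lub each) (⌈/4⌉-least total)

Φ-uniform : ∀ w → Φ (λ _ → w) ≤ ceil5/4 w
Φ-uniform w = Φ-least (λ _ → w≤g) (≤-trans (∑-upper {k = 5} {f = λ _ → w} (λ _ → ≤-refl)) (≤-4*⌈/4⌉ (5 * w)))
  where
  w≤g : w ≤ ceil5/4 w
  w≤g = *-cancelˡ-≤ 4 (≤-trans (*-monoˡ-≤ w (n≤1+n 4)) (≤-4*⌈/4⌉ (5 * w)))

-- If the potential is positive, some window carries strictly less than it: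
-- otherwise the five loads would sum to at least 5 Φ > 4 Φ.
light-window : ∀ p → 0 < Φ p → ∃ λ j → p j < Φ p
light-window p pos with any? (λ j → p j <? Φ p)
... | yes found = found
... | no none = contradiction (+-cancelʳ-≤ (4 * Φ p) (Φ p) 0 (≤-trans (∑-lower heavy) (∑≤4Φ p))) (<⇒≱ pos)
  where
  heavy : ∀ j → Φ p ≤ p j
  heavy j = ≮⇒≥ (λ lt → none (j , lt))

off : Window → Window → ℕ
off j i with i ≟ j
... | yes _ = 0
... | no _ = 1

∑-off : ∀ j → ∑ (off j) ≡ 4
∑-off 0F = refl
∑-off 1F = refl
∑-off 2F = refl
∑-off 3F = refl
∑-off 4F = refl

<⇒≤∸1 : ∀ {a b} → a < b → a ≤ b ∸ 1
<⇒≤∸1 (s≤s a≤b) = a≤b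

≤∸1⇒< : ∀ {a b} → 0 < b → a ≤ b ∸ 1 → a < b
≤∸1⇒< {b = suc b} _ a≤b = s≤s a≤b

-- Lowering every window but j by one, and keeping window j below both its old
-- load and the potential, lowers the potential: all new loads are < Φ, and the
-- sum drops by at least 4.
potential-drop : ∀ (p q : Load) j → (∀ i → i ≢ j → q i < p i) → q j ≤ p j → q j < Φ p → Φ q < Φ p
potential-drop p q j lower keep cap = ≤∸1⇒< (≤-<-trans z≤n cap) (Φ-least below total)
  where
  F = Φ p
  below : ∀ i → q i ≤ F ∸ 1
  below i with i ≟ j
  ... | yes refl = <⇒≤∸1 cap
  ... | no i≢j = <⇒≤∸1 (<-≤-trans (lower i i≢j) (load≤Φ p i))
  shifted : ∀ i → q i + off j i ≤ p i
  shifted i with i ≟ j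
  ... | yes refl = ≤-trans (≤-reflexive (+-identityʳ (q j))) keep
  ... | no i≢j = ≤-trans (≤-reflexive (+-comm (q i) 1)) (lower i i≢j)
  total : ∑ q ≤ 4 * (F ∸ 1)
  total = subst (∑ q ≤_) (sym (*-distribˡ-∸ 4 F 1)) (m+n≤o⇒m≤o∸n (∑ q) (begin
    ∑ q + 4                    ≡⟨ cong (∑ q +_) (∑-off j) ⟨
    ∑ q + ∑ (off j)           ≡⟨ ∑-+ q (off j) ⟨
    ∑ (λ i → q i + off j i)    ≤⟨ ∑-mono shifted ⟩
    ∑ p                        ≤⟨ ∑≤4Φ p ⟩
    4 * F                         ∎))
    where open ≤-Reasoning

select : ∀ {n} {P : Pred (Fin n) 0ℓ} → Decidable P → Subset n
select P? = tabulate (λ u → does (P? u))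

∈-select⁺ : ∀ {n} {P : Pred (Fin n) 0ℓ} (P? : Decidable P) {u} → P u → u ∈ select P?
∈-select⁺ P? {u} pu = lookup⇒[]= u (select P?) (trans (lookup∘tabulate _ u) (dec-true (P? u) pu))

∈-select⁻ : ∀ {n} {P : Pred (Fin n) 0ℓ} (P? : Decidable P) {u} → u ∈ select P? → P u
∈-select⁻ P? {u} u∈ with P? u | trans (sym (lookup∘tabulate _ u)) ([]=⇒lookup u∈)
... | yes pu | _ = pu
... | no _ | ()

∈─⁻ : ∀ {n} (p q : Subset n) {u} → u ∈ p ─ q → u ∉ q
∈─⁻ (_ ∷ p) (outside ∷ q) here ()
∈─⁻ (_ ∷ p) (_ ∷ q) (there u∈) (there u∈q) = ∈─⁻ p q u∈ u∈q

∈⁅⁆∪⁻ : ∀ {n} {a : Fin n} {q u} → u ∈ ⁅ a ⁆ ∪ q → u ≡ a ⊎ u ∈ q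
∈⁅⁆∪⁻ {a = a} {q} u∈ with x∈p∪q⁻ ⁅ a ⁆ q u∈
... | inj₁ u∈a = inj₁ (x∈⁅y⁆⇒x≡y a u∈a)
... | inj₂ u∈q = inj₂ u∈q

∈⁅⁆∪-here : ∀ {n} {a : Fin n} {q} → a ∈ ⁅ a ⁆ ∪ q
∈⁅⁆∪-here {a = a} = x∈p∪q⁺ (inj₁ (x∈⁅x⁆ a))

∈⁅⁆∪-there : ∀ {n} {a : Fin n} {q u} → u ∈ q → u ∈ ⁅ a ⁆ ∪ q
∈⁅⁆∪-there u∈q = x∈p∪q⁺ (inj₂ u∈q)

⁅⁆∪-⊆ : ∀ {n} {a : Fin n} {q U} → a ∈ U → q ⊆ U → ⁅ a ⁆ ∪ q ⊆ U
⁅⁆∪-⊆ a∈U q⊆U u∈ with ∈⁅⁆∪⁻ u∈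
... | inj₁ refl = a∈U
... | inj₂ u∈q = q⊆U u∈q

⁅⁆-⊆ : ∀ {n} {a : Fin n} {U} → a ∈ U → ⁅ a ⁆ ⊆ U
⁅⁆-⊆ {a = a} a∈U u∈ with x∈⁅y⁆⇒x≡y a u∈
... | refl = a∈U

-- A fixed set of fewer than k vertices misses one of the colours 0, …, k-1:
-- if colour k-1 occurs, discard its colour class and recurse.
free-colour : ∀ {n} (c : Fin n → ℕ) k (K : Subset n) → ∣ K ∣ < k → ∃ λ j → j < k × ∀ u → u ∈ K → c u ≢ j
free-colour c (suc k) K size with any? (λ u → u ∈? K ×-dec c u ℕ.≟ k)
... | no unused = k , n<1+n k , λ u u∈K cu≡k → unused (u , u∈K , cu≡k)
... | yes (u₀ , u₀∈K , cu₀≡k) = j , m≤n⇒m≤1+n j<k , avoids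
  where
  coloured-k? : Decidable (λ u → c u ≡ k)
  coloured-k? u = c u ℕ.≟ k
  classₖ = select coloured-k?
  smaller : ∣ K ─ classₖ ∣ < k
  smaller = <-≤-trans (p∩q≢∅⇒∣p─q∣<∣p∣ K classₖ (u₀ , x∈p∩q⁺ (u₀∈K , ∈-select⁺ coloured-k? cu₀≡k)))
                      (≤-pred size)
  rest = free-colour c k (K ─ classₖ) smaller
  j = proj₁ rest
  j<k = proj₁ (proj₂ rest)
  avoids : ∀ u → u ∈ K → c u ≢ j
  avoids u u∈K with c u ℕ.≟ k
  ... | yes cu≡k = λ cu≡j → <-irrefl (trans (sym cu≡j) cu≡k) j<k
  ... | no cu≢k = proj₂ (proj₂ rest) u (x∈p∧x∉q⇒x∈p─q u∈K (cu≢k ∘ ∈-select⁻ coloured-k?))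

greatest : ∀ {n} {P : Pred (Fin n) 0ℓ} → Decidable P → (_≼_ : Fin n → Fin n → Set) →
           (∀ {x} → x ≼ x) → (∀ {x y z} → x ≼ y → y ≼ z → x ≼ z) →
           (∀ {x y} → P x → P y → x ≼ y ⊎ y ≼ x) →
           Σ (Fin n) P → Σ[ m ∈ Fin n ] P m × (∀ x → P x → x ≼ m)
greatest {n} {P} P? _≼_ ≼-refl ≼-trans ≼-total (x₀ , px₀) with scan (allFin n) x₀ px₀
  where
  scan : (xs : List (Fin n)) → ∀ m → P m →
         Σ[ m′ ∈ Fin n ] P m′ × m ≼ m′ × (∀ x → x ∈ₗ xs → P x → x ≼ m′)
  scan [] m pm = m , pm , ≼-refl , λ _ ()
  scan (x ∷ xs) m pm with P? x
  ... | no ¬px = let (m′ , pm′ , m≼m′ , above) = scan xs m pm in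
    m′ , pm′ , m≼m′ , λ { y (here refl) py → contradiction py ¬px ; y (there y∈xs) py → above y y∈xs py }
  ... | yes px with ≼-total px pm
  ... | inj₁ x≼m = let (m′ , pm′ , m≼m′ , above) = scan xs m pm in
    m′ , pm′ , m≼m′ , λ { y (here refl) _ → ≼-trans x≼m m≼m′ ; y (there y∈xs) py → above y y∈xs py }
  ... | inj₂ m≼x = let (m′ , pm′ , x≼m′ , above) = scan xs x px in
    m′ , pm′ , ≼-trans m≼x x≼m′ , λ { y (here refl) _ → x≼m′ ; y (there y∈xs) py → above y y∈xs py }
... | m , pm , _ , above = m , pm , λ x px → above x (∈-allFin x) px

module Peeling {n : ℕ} (G : Graph n) (window : Window → Subset n) where

  Stable : Subset n → Set
  Stable S = ∀ u v → u ∈ S → v ∈ S → ¬ Adj G u v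

  CliqueIn : Subset n → Window → Subset n → Set
  CliqueIn U i K = IsClique G K × K ⊆ U × K ⊆ window i

  CliqueBound : Subset n → Window → ℕ → Set
  CliqueBound U i b = ∀ K → CliqueIn U i K → ∣ K ∣ ≤ b

  Bounded : Subset n → Load → Set
  Bounded U p = ∀ i → CliqueBound U i (p i)

  clique-⊆ : ∀ {U V i K} → V ⊆ U → CliqueIn V i K → CliqueIn U i K
  clique-⊆ V⊆U (cl , K⊆V , K⊆W) = cl , V⊆U ∘ K⊆V , K⊆W

  bounded-⊆ : ∀ {U V p} → V ⊆ U → Bounded U p → Bounded V p
  bounded-⊆ V⊆U bnd i K c = bnd i K (clique-⊆ V⊆U c)

  empty-clique : ∀ {U i} → CliqueIn U i ∅
  empty-clique = (λ u v u∈ → contradiction u∈ ∉⊥) , ⊥⊆ , ⊥⊆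

  extension-bound : ∀ {U i b K v} → CliqueBound U i b → CliqueIn U i K →
                    v ∈ U → v ∈ window i → v ∉ K → (∀ u → u ∈ K → Adj G v u) → suc ∣ K ∣ ≤ b
  extension-bound {K = K} {v} bound (clique , K⊆U , K⊆W) v∈U v∈W v∉K v~K =
    ≤-trans (p⊂q⇒∣p∣<∣q∣ (q⊆p∪q ⁅ v ⁆ K , v , ∈⁅⁆∪-here , v∉K))
            (bound (⁅ v ⁆ ∪ K) (clique′ , ⁅⁆∪-⊆ v∈U K⊆U , ⁅⁆∪-⊆ v∈W K⊆W))
    where
    clique′ : IsClique G (⁅ v ⁆ ∪ K)
    clique′ u w u∈ w∈ u≢w with ∈⁅⁆∪⁻ u∈ | ∈⁅⁆∪⁻ w∈
    ... | inj₁ refl | inj₁ refl = contradiction refl u≢w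
    ... | inj₁ refl | inj₂ w∈K = v~K w w∈K
    ... | inj₂ u∈K | inj₁ refl = adj-sym G (v~K u u∈K)
    ... | inj₂ u∈K | inj₂ w∈K = clique u w u∈K w∈K u≢w

  vertex-load : ∀ {U p i} {v : Fin n} → Bounded U p → v ∈ U → v ∈ window i → 0 < p i
  vertex-load {i = i} bnd v∈U v∈W =
    subst (_< _) (∣⊥∣≡0 n) (extension-bound (bnd i) empty-clique v∈U v∈W ∉⊥ (λ u u∈∅ → contradiction u∈∅ ∉⊥))

  Hits : Subset n → Subset n → Window → Set
  Hits U S i = ∀ K → CliqueIn (U ─ S) i K → Σ[ s ∈ Fin n ] s ∈ S × s ∈ window i × (∀ u → u ∈ K → Adj G s u)

  avoiding : ∀ {U S K : Subset n} {s u} → K ⊆ U ─ S → s ∈ S → u ∈ K → u ≢ s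
  avoiding {U} {S} K⊆U─S s∈S u∈K refl = ∈─⁻ U S (K⊆U─S u∈K) s∈S

  hits-bound : ∀ {U S i b K} → S ⊆ U → CliqueBound U i b → Hits U S i → CliqueIn (U ─ S) i K → suc ∣ K ∣ ≤ b
  hits-bound {U} {S} S⊆U bound hits c@(_ , K⊆U─S , _) with hits _ c
  ... | s , s∈S , s∈W , s~K =
    extension-bound bound (clique-⊆ (p─q⊆p U S) c) (S⊆U s∈S) s∈W (λ s∈K → avoiding K⊆U─S s∈S s∈K refl) s~K

  dominant-hits : ∀ {U S : Subset n} {i s} → s ∈ S → s ∈ window i →
                  (∀ u → u ∈ U → u ∈ window i → u ≢ s → Adj G s u) → Hits U S i
  dominant-hits {U} {S} s∈S s∈W dominates K (_ , K⊆U─S , K⊆W) =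
    _ , s∈S , s∈W , λ u u∈K → dominates u (p─q⊆p U S (K⊆U─S u∈K)) (K⊆W u∈K) (avoiding K⊆U─S s∈S u∈K)

  stable-⁅⁆ : ∀ {a : Fin n} → Stable ⁅ a ⁆
  stable-⁅⁆ {a} u v u∈ v∈ with x∈⁅y⁆⇒x≡y a u∈ | x∈⁅y⁆⇒x≡y a v∈
  ... | refl | refl = irrefl G

  stable-⁅⁆∪ : ∀ {a : Fin n} {q} → Stable q → (∀ v → v ∈ q → ¬ Adj G a v) → Stable (⁅ a ⁆ ∪ q)
  stable-⁅⁆∪ stable a≁q u v u∈ v∈ with ∈⁅⁆∪⁻ u∈ | ∈⁅⁆∪⁻ v∈
  ... | inj₁ refl | inj₁ refl = irrefl G
  ... | inj₁ refl | inj₂ v∈q = a≁q v v∈q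
  ... | inj₂ u∈q | inj₁ refl = a≁q u u∈q ∘ adj-sym G
  ... | inj₂ u∈q | inj₂ v∈q = stable u v u∈q v∈q

  stable-pair : ∀ {a b : Fin n} → ¬ Adj G a b → Stable (⁅ a ⁆ ∪ ⁅ b ⁆)
  stable-pair {b = b} a≁b = stable-⁅⁆∪ stable-⁅⁆ λ v v∈ → subst (¬_ ∘ Adj G _) (sym (x∈⁅y⁆⇒x≡y b v∈)) a≁b

  stable-triple : ∀ {a b c : Fin n} → ¬ Adj G a b → ¬ Adj G a c → ¬ Adj G b c → Stable (⁅ a ⁆ ∪ (⁅ b ⁆ ∪ ⁅ c ⁆))
  stable-triple {a} {b} {c} a≁b a≁c b≁c = stable-⁅⁆∪ (stable-pair b≁c) a≁bc
    where
    a≁bc : ∀ v → v ∈ ⁅ b ⁆ ∪ ⁅ c ⁆ → ¬ Adj G a v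
    a≁bc v v∈ with ∈⁅⁆∪⁻ v∈
    ... | inj₁ refl = a≁b
    ... | inj₂ v∈c with x∈⁅y⁆⇒x≡y c v∈c
    ... | refl = a≁c

  nbhd : Subset n → Fin n → Subset n
  nbhd U v = U ∩ select (adj? G v)

  nbhd⁻ : ∀ {U v u} → u ∈ nbhd U v → u ∈ U × Adj G v u
  nbhd⁻ {U} {v} u∈ with x∈p∩q⁻ U _ u∈
  ... | u∈U , u∈N = u∈U , ∈-select⁻ (adj? G v) u∈N

  nbhd⁺ : ∀ {U v u} → u ∈ U → Adj G v u → u ∈ nbhd U v
  nbhd⁺ {v = v} u∈U v~u = x∈p∩q⁺ (u∈U , ∈-select⁺ (adj? G v) v~u)

  record Simplicial (U : Subset n) : Set where
    field
      vertex  : Fin n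
      win     : Window
      ∈U      : vertex ∈ U
      ∈W      : vertex ∈ window win
      nbrs-in : ∀ u → u ∈ U → Adj G vertex u → u ∈ window win
      nbrs-adjacent : ∀ u w → u ∈ U → w ∈ U → Adj G vertex u → Adj G vertex w → u ≢ w → Adj G u w

  -- A simplicial vertex has fewer than Φ p neighbours: together with it they form a clique of its window.
  simplicial-degree : ∀ {U p} → Bounded U p → (s : Simplicial U) → ∣ nbhd U (Simplicial.vertex s) ∣ < Φ p
  simplicial-degree {U} {p} bnd s =
    ≤-trans (extension-bound (bnd win) clique ∈U ∈W v∉N (λ u → proj₂ ∘ nbhd⁻)) (load≤Φ p win)
    where
    open Simplicial s
    v∉N : vertex ∉ nbhd U vertex
    v∉N v∈N = irrefl G (proj₂ (nbhd⁻ v∈N))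
    clique : CliqueIn U win (nbhd U vertex)
    clique = (λ u w u∈ w∈ → nbrs-adjacent u w (proj₁ (nbhd⁻ u∈)) (proj₁ (nbhd⁻ w∈))
                                               (proj₂ (nbhd⁻ u∈)) (proj₂ (nbhd⁻ w∈)))
           , (proj₁ ∘ nbhd⁻)
           , (λ u∈ → nbrs-in _ (proj₁ (nbhd⁻ u∈)) (proj₂ (nbhd⁻ u∈)))

  record Peel (U : Subset n) (p : Load) : Set where
    field
      S        : Subset n
      S⊆U      : S ⊆ U
      occupied : Nonempty S
      stable   : Stable S
      p′       : Load
      bounded  : Bounded (U ─ S) p′
      drop     : Φ p′ < Φ p

  -- A stable S ⊆ U that hits every window except j, such that the cliques of
  -- window j avoiding S stay below Φ p, can be peeled: lower every other
  -- window by one and cap window j at Φ p - 1.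
  peel : ∀ {U p} → Bounded U p → (S : Subset n) → S ⊆ U → Stable S → (j : Window) →
         (∀ i → i ≢ j → Hits U S i) → (∀ K → CliqueIn (U ─ S) j K → ∣ K ∣ < Φ p) → Peel U p
  peel {U} {p} bnd S S⊆U stable j hits small = record
    { S = S ; S⊆U = S⊆U ; occupied = occupied ; stable = stable
    ; p′ = lowered ; bounded = bounded ; drop = potential-drop p lowered j lower keep cap }
    where
    lowered : Load
    lowered i with i ≟ j
    ... | yes _ = p j ⊓ (Φ p ∸ 1)
    ... | no _ = p i ∸ 1
    -- the windows other than j contain a vertex of S, hence carry a positive load
    positive : ∀ i → i ≢ j → 0 < p i
    positive i i≢j = subst (_< p i) (∣⊥∣≡0 n) (hits-bound S⊆U (bnd i) (hits i i≢j) empty-clique)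
    occupied : Nonempty S
    occupied with hits (another j) (another-≢ j) ∅ empty-clique
    ... | s , s∈S , _ = s , s∈S
    Φ-positive : 0 < Φ p
    Φ-positive = <-≤-trans (positive (another j) (another-≢ j)) (load≤Φ p (another j))
    bounded : Bounded (U ─ S) lowered
    bounded i K c with i ≟ j
    ... | yes refl = ⊓-glb (bnd j K (clique-⊆ (p─q⊆p U S) c)) (<⇒≤∸1 (small K c))
    ... | no i≢j = <⇒≤∸1 (hits-bound S⊆U (bnd i) (hits i i≢j) c)
    lower : ∀ i → i ≢ j → lowered i < p i
    lower i i≢j with i ≟ j
    ... | yes i≡j = contradiction i≡j i≢j
    ... | no _ = ≤∸1⇒< (positive i i≢j) ≤-refl
    keep : lowered j ≤ p j
    keep with j ≟ j
    ... | yes _ = m⊓n≤m _ _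
    ... | no j≢j = contradiction refl j≢j
    cap : lowered j < Φ p
    cap with j ≟ j
    ... | yes _ = ≤∸1⇒< Φ-positive (m⊓n≤n _ _)
    ... | no j≢j = contradiction refl j≢j

  Colouring : Subset n → ℕ → Set
  Colouring U k = Σ[ c ∈ (Fin n → ℕ) ]
    (∀ u → u ∈ U → c u < k) × (∀ u v → u ∈ U → v ∈ U → Adj G u v → c u ≢ c v)

  colouring-mono : ∀ {U k k′} → k ≤ k′ → Colouring U k → Colouring U k′
  colouring-mono k≤k′ (c , below , proper) = c , (λ u u∈ → <-≤-trans (below u u∈) k≤k′) , proper

  extend-vertex : ∀ {U v k} → v ∈ U → Colouring (U - v) k → ∣ nbhd U v ∣ < k → Colouring U k
  extend-vertex {U} {v} {k} v∈U (c , below , proper) small = c′ , below′ , proper′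
    where
    fresh = free-colour c k (nbhd U v) small
    c′ : Fin n → ℕ
    c′ u with u ≟ v
    ... | yes _ = proj₁ fresh
    ... | no _ = c u
    fresh-ok : ∀ w → w ∈ U → Adj G v w → proj₁ fresh ≢ c w
    fresh-ok w w∈U v~w = proj₂ (proj₂ fresh) w (nbhd⁺ w∈U v~w) ∘ sym
    below′ : ∀ u → u ∈ U → c′ u < k
    below′ u u∈U with u ≟ v
    ... | yes _ = proj₁ (proj₂ fresh)
    ... | no u≢v = below u (x∈p∧x≢y⇒x∈p-y u∈U u≢v)
    proper′ : ∀ u w → u ∈ U → w ∈ U → Adj G u w → c′ u ≢ c′ w
    proper′ u w u∈U w∈U u~w with u ≟ v | w ≟ v
    ... | yes refl | yes refl = contradiction u~w (irrefl G)
    ... | yes refl | no _ = fresh-ok w w∈U u~w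
    ... | no _ | yes refl = fresh-ok u u∈U (adj-sym G u~w) ∘ sym
    ... | no u≢v | no w≢v = proper u w (x∈p∧x≢y⇒x∈p-y u∈U u≢v) (x∈p∧x≢y⇒x∈p-y w∈U w≢v) u~w

  extend-stable : ∀ {U S k} → Stable S → Colouring (U ─ S) k → Colouring U (suc k)
  extend-stable {U} {S} {k} stable (c , below , proper) = c′ , below′ , proper′
    where
    c′ : Fin n → ℕ
    c′ u with u ∈? S
    ... | yes _ = k
    ... | no _ = c u
    below′ : ∀ u → u ∈ U → c′ u < suc k
    below′ u u∈U with u ∈? S
    ... | yes _ = n<1+n k
    ... | no u∉S = m≤n⇒m≤1+n (below u (x∈p∧x∉q⇒x∈p─q u∈U u∉S))
    proper′ : ∀ u w → u ∈ U → w ∈ U → Adj G u w → c′ u ≢ c′ w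
    proper′ u w u∈U w∈U u~w with u ∈? S | w ∈? S
    ... | yes u∈S | yes w∈S = contradiction u~w (stable u w u∈S w∈S)
    ... | yes _ | no w∉S = λ k≡cw → <-irrefl (sym k≡cw) (below w (x∈p∧x∉q⇒x∈p─q w∈U w∉S))
    ... | no u∉S | yes _ = λ cu≡k → <-irrefl cu≡k (below u (x∈p∧x∉q⇒x∈p─q u∈U u∉S))
    ... | no u∉S | no w∉S = proper u w (x∈p∧x∉q⇒x∈p─q u∈U u∉S) (x∈p∧x∉q⇒x∈p─q w∈U w∉S) u~w

  colorable : ∀ {k} → Colouring ⊤ k → Colorable G k
  colorable {k} (c , below , proper) = c′ , proper′
    where
    c′ : Fin n → Fin k
    c′ u = fromℕ< (below u ∈⊤)
    proper′ : ∀ u v → Adj G u v → c′ u ≢ c′ v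
    proper′ u v u~v c′u≡c′v = proper u v ∈⊤ ∈⊤ u~v (begin
      c u                  ≡⟨ toℕ-fromℕ< (below u ∈⊤) ⟨
      toℕ (c′ u)           ≡⟨ cong toℕ c′u≡c′v ⟩
      toℕ (c′ v)           ≡⟨ toℕ-fromℕ< (below v ∈⊤) ⟩
      c v                  ∎)
      where open ≡-Reasoning

  Reduction : Set
  Reduction = ∀ U p → Bounded U p → Nonempty U → Simplicial U ⊎ Peel U p

  colour : Reduction → ∀ U p → Bounded U p → Colouring U (Φ p)
  colour reduce U = go U (<-wellFounded ∣ U ∣)
    where
    go : ∀ U → Acc _<_ ∣ U ∣ → ∀ p → Bounded U p → Colouring U (Φ p)
    go U (acc smaller) p bnd with nonempty? U
    ... | no empty = (λ _ → 0) , (λ u u∈U → contradiction (u , u∈U) empty)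
                               , (λ u _ u∈U → contradiction (u , u∈U) empty)
    ... | yes nonempty with reduce U p bnd nonempty
    ... | inj₁ s = extend-vertex ∈U
          (go (U - vertex) (smaller (x∈p⇒∣p-x∣<∣p∣ ∈U)) p (bounded-⊆ (p─q⊆p U ⁅ vertex ⁆) bnd))
          (simplicial-degree bnd s)
      where open Simplicial s
    ... | inj₂ pl = colouring-mono drop (extend-stable stable
          (go (U ─ S) (smaller (p∩q≢∅⇒∣p─q∣<∣p∣ U S (s , x∈p∩q⁺ (S⊆U s∈S , s∈S)))) p′ bounded))
      where
      open Peel pl
      s = proj₁ occupied
      s∈S = proj₂ occupied

part-index : Part → ℕ
part-index Q1 = 0
part-index Q2 = 1
part-index Q3 = 2
part-index Q4 = 3
part-index Q5 = 4
part-index R2 = 5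
part-index R3 = 6

part-at : ℕ → Part
part-at 0 = Q1
part-at 1 = Q2
part-at 2 = Q3
part-at 3 = Q4
part-at 4 = Q5
part-at 5 = R2
part-at _ = R3

part-at-index : ∀ a → part-at (part-index a) ≡ a
part-at-index Q1 = refl
part-at-index Q2 = refl
part-at-index Q3 = refl
part-at-index Q4 = refl
part-at-index Q5 = refl
part-at-index R2 = refl
part-at-index R3 = refl

_≟P_ : (a b : Part) → Dec (a ≡ b)
a ≟P b = map′ (λ e → trans (sym (part-at-index a)) (trans (cong part-at e) (part-at-index b)))
              (cong part-index) (part-index a ℕ.≟ part-index b)

parts : List Part
parts = Q1 ∷ Q2 ∷ Q3 ∷ Q4 ∷ Q5 ∷ R2 ∷ R3 ∷ []

∈-parts : ∀ a → a ∈ₗ parts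
∈-parts Q1 = here refl
∈-parts Q2 = there (here refl)
∈-parts Q3 = there (there (here refl))
∈-parts Q4 = there (there (there (here refl)))
∈-parts Q5 = there (there (there (there (here refl))))
∈-parts R2 = there (there (there (there (there (here refl)))))
∈-parts R3 = there (there (there (there (there (there (here refl))))))

-- A Boolean property of every part (pair of parts, …) holds once the
-- decision procedure evaluates to yes on the explicit enumeration.
inspect-parts : (f : Part → Bool) → {True (All.all? (T? ∘ f) parts)} → ∀ a → T (f a)
inspect-parts f {ok} a = All.lookup (toWitness ok) (∈-parts a)

inspect-pairs : (f : Part → Part → Bool) → {True (All.all? (λ a → All.all? (T? ∘ f a) parts) parts)} →
                ∀ a b → T (f a b)
inspect-pairs f {ok} a b = All.lookup (All.lookup (toWitness ok) (∈-parts a)) (∈-parts b)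

inspect-window-pairs : (f : Window → Part → Part → Bool) →
  {True (Fin.all? (λ i → All.all? (λ a → All.all? (T? ∘ f i a) parts) parts))} → ∀ i a b → T (f i a b)
inspect-window-pairs f {ok} i a b = All.lookup (All.lookup (toWitness ok i) (∈-parts a)) (∈-parts b)

inspect-windows : (f : Window → Window → Bool) → {True (Fin.all? (λ i → Fin.all? (λ j → T? (f i j))))} →
                  ∀ i j → T (f i j)
inspect-windows f {ok} i j = toWitness ok i j

∨-cases : ∀ x {y} → T (x ∨ y) → T x ⊎ T y
∨-cases true _ = inj₁ tt
∨-cases false h = inj₂ h

not-T : ∀ x → T (not x) → ¬ T x
not-T true () _
not-T false _ ()

completeDir : Part → Part → Bool
completeDir Q5 Q1 = true
completeDir Q5 Q4 = true
completeDir R2 Q1 = true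
completeDir R2 Q2 = true
completeDir R2 Q3 = true
completeDir R3 Q2 = true
completeDir R3 Q3 = true
completeDir R3 Q4 = true
completeDir Q2 Q3 = true
completeDir _ _ = false

emptyDir : Part → Part → Bool
emptyDir Q1 Q3 = true
emptyDir Q1 R3 = true
emptyDir Q1 Q4 = true
emptyDir Q4 Q2 = true
emptyDir Q4 R2 = true
emptyDir Q5 Q2 = true
emptyDir Q5 R2 = true
emptyDir Q5 Q3 = true
emptyDir Q5 R3 = true
emptyDir _ _ = false

Linked : Part → Part → Bool
Linked a b = ⌊ a ≟P b ⌋ ∨ completeDir a b ∨ completeDir b a

Apart : Part → Part → Bool
Apart a b = emptyDir a b ∨ emptyDir b a

-- The parts sit in five zones around a cycle,  Q5 | Q1 | Q2,R2 | Q3,R3 | Q4,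
-- and window i is the union of the consecutive zones i and i+1.
zone : Part → Window
zone Q5 = 0F
zone Q1 = 1F
zone Q2 = 2F
zone R2 = 2F
zone Q3 = 3F
zone R3 = 3F
zone Q4 = 4F

next : Window → Window
next 0F = 1F
next 1F = 2F
next 2F = 3F
next 3F = 4F
next 4F = 0F

prev : Window → Window
prev 0F = 4F
prev 1F = 0F
prev 2F = 1F
prev 3F = 2F
prev 4F = 3F

zoneIn : Window → Window → Bool
zoneIn i z = ⌊ z ≟ i ⌋ ∨ ⌊ z ≟ next i ⌋

inWindow : Window → Part → Bool
inWindow i a = zoneIn i (zone a)

-- The graded pair {X,Y} inside window i, with X the side whose Y-neighbourhoods are nested.
GradedIn : Window → Part → Part → Set
GradedIn 1F a b = a ≡ Q1 × b ≡ Q2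
GradedIn 2F a b = a ≡ R2 × b ≡ R3
GradedIn 3F a b = a ≡ Q3 × b ≡ Q4
GradedIn _ _ _ = ⊥

gradedIn? : ∀ i a b → Dec (GradedIn i a b)
gradedIn? 0F a b = no λ ()
gradedIn? 1F a b = (a ≟P Q1) ×-dec (b ≟P Q2)
gradedIn? 2F a b = (a ≟P R2) ×-dec (b ≟P R3)
gradedIn? 3F a b = (a ≟P Q3) ×-dec (b ≟P Q4)
gradedIn? 4F a b = no λ ()

window-pairs : ∀ i a b → T (not (inWindow i a) ∨ not (inWindow i b) ∨
                            Linked a b ∨ ⌊ gradedIn? i a b ⌋ ∨ ⌊ gradedIn? i b a ⌋)
window-pairs = inspect-window-pairs _

neighbour-zones : ∀ a b → T (Apart a b ∨ ⌊ zone b ≟ prev (zone a) ⌋ ∨ inWindow (zone a) b)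
neighbour-zones = inspect-pairs _

two-zones-apart : ∀ a b → T (not ⌊ zone b ≟ next (next (zone a)) ⌋ ∨ Apart a b)
two-zones-apart = inspect-pairs _

windows-covered : ∀ i j → T (⌊ i ≟ j ⌋ ∨ zoneIn i (next (next j)) ∨ zoneIn i (next (next (next (next j)))))
windows-covered = inspect-windows _

window3-without-Q4 : ∀ a → T (not (inWindow 3F a) ∨ ⌊ a ≟P Q4 ⌋ ∨ inWindow 2F a)
window3-without-Q4 = inspect-parts _

window1-without-Q1 : ∀ a → T (not (inWindow 1F a) ∨ ⌊ a ≟P Q1 ⌋ ∨ inWindow 2F a)
window1-without-Q1 = inspect-parts _

module Band {n : ℕ} (G : Graph n) (part : Fin n → Part) (band : IsBandPartition G part) where
  open IsBandPartition band

  window : Window → Subset n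
  window i = select (λ u → T? (inWindow i (part u)))

  open Peeling G window

  ∈-window⁺ : ∀ {i u} → T (inWindow i (part u)) → u ∈ window i
  ∈-window⁺ {i} = ∈-select⁺ (λ u → T? (inWindow i (part u)))

  ∈-window⁻ : ∀ {i u} → u ∈ window i → T (inWindow i (part u))
  ∈-window⁻ {i} = ∈-select⁻ (λ u → T? (inWindow i (part u)))

  zone-∈-window : ∀ {i u z} → zone (part u) ≡ z → T (zoneIn i z) → u ∈ window i
  zone-∈-window {i} zu≡z h = ∈-window⁺ (subst (T ∘ zoneIn i) (sym zu≡z) h)

  complete-adj : ∀ u v → T (completeDir (part u) (part v)) → Adj G u v
  complete-adj u v h with part u in pu | part v in pv
  ... | Q5 | Q1 = c-Q5-Q1 u v pu pv
  ... | Q5 | Q4 = c-Q5-Q4 u v pu pv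
  ... | R2 | Q1 = c-R2-Q1 u v pu pv
  ... | R2 | Q2 = c-R2-Q2 u v pu pv
  ... | R2 | Q3 = c-R2-Q3 u v pu pv
  ... | R3 | Q2 = c-R3-Q2 u v pu pv
  ... | R3 | Q3 = c-R3-Q3 u v pu pv
  ... | R3 | Q4 = c-R3-Q4 u v pu pv
  ... | Q2 | Q3 = c-Q2-Q3 u v pu pv

  empty-nonadj : ∀ u v → T (emptyDir (part u) (part v)) → ¬ Adj G u v
  empty-nonadj u v h with part u in pu | part v in pv
  ... | Q1 | Q3 = e-Q1-Q3 u v pu pv
  ... | Q1 | R3 = e-Q1-R3 u v pu pv
  ... | Q1 | Q4 = e-Q1-Q4 u v pu pv
  ... | Q4 | Q2 = e-Q4-Q2 u v pu pv
  ... | Q4 | R2 = e-Q4-R2 u v pu pv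
  ... | Q5 | Q2 = e-Q5-Q2 u v pu pv
  ... | Q5 | R2 = e-Q5-R2 u v pu pv
  ... | Q5 | Q3 = e-Q5-Q3 u v pu pv
  ... | Q5 | R3 = e-Q5-R3 u v pu pv

  linked-adj : ∀ {u w} → u ≢ w → T (Linked (part u) (part w)) → Adj G u w
  linked-adj {u} {w} u≢w h with ∨-cases ⌊ part u ≟P part w ⌋ h
  ... | inj₁ same = cliques (part w) u w (toWitness same) refl u≢w
  ... | inj₂ h′ with ∨-cases (completeDir (part u) (part w)) h′
  ... | inj₁ uw = complete-adj u w uw
  ... | inj₂ wu = adj-sym G (complete-adj w u wu)

  apart-nonadj : ∀ {u w} → T (Apart (part u) (part w)) → ¬ Adj G u w
  apart-nonadj {u} {w} h with ∨-cases (emptyDir (part u) (part w)) h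
  ... | inj₁ uw = empty-nonadj u w uw
  ... | inj₂ wu = empty-nonadj w u wu ∘ adj-sym G

  window-adjacent : ∀ {i u w} → u ∈ window i → w ∈ window i → u ≢ w →
                    Adj G u w ⊎ GradedIn i (part u) (part w) ⊎ GradedIn i (part w) (part u)
  window-adjacent {i} {u} {w} u∈W w∈W u≢w with ∨-cases (not (inWindow i (part u))) (window-pairs i (part u) (part w))
  ... | inj₁ u∉W = contradiction (∈-window⁻ u∈W) (not-T _ u∉W)
  ... | inj₂ h with ∨-cases (not (inWindow i (part w))) h
  ... | inj₁ w∉W = contradiction (∈-window⁻ w∈W) (not-T _ w∉W)
  ... | inj₂ h′ with ∨-cases (Linked (part u) (part w)) h′
  ... | inj₁ linked = inj₁ (linked-adj u≢w linked)
  ... | inj₂ h″ with ∨-cases ⌊ gradedIn? i (part u) (part w) ⌋ h″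
  ... | inj₁ uw = inj₂ (inj₁ (toWitness uw))
  ... | inj₂ wu = inj₂ (inj₂ (toWitness wu))

  incl-at? : ∀ X y y′ x → Dec (part x ≡ X → Adj G y x → Adj G y′ x)
  incl-at? X y y′ x = (part x ≟P X) →-dec (adj? G y x →-dec adj? G y′ x)

  graded-sym : ∀ {X Y} → Graded G part X Y → Graded G part Y X
  graded-sym {X} {Y} graded y y′ py py′ with Fin.all? (incl-at? X y y′)
  ... | yes y⊑y′ = inj₁ (λ x → y⊑y′ x)
  ... | no y⋢y′ with Fin.¬∀⟶∃¬ n _ (incl-at? X y y′) y⋢y′
  ... | x , ¬incl with part x ≟P X | adj? G y x | adj? G y′ x
  ... | no ¬px | _ | _ = contradiction (λ px → contradiction px ¬px) ¬incl
  ... | yes _ | no y≁x | _ = contradiction (λ _ y~x → contradiction y~x y≁x) ¬incl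
  ... | yes _ | yes _ | yes y′~x = contradiction (λ _ _ → y′~x) ¬incl
  ... | yes px | yes y~x | no y′≁x = inj₂ y′⊑y
    where
    y′⊑y : NbhdIncl G part X y′ y
    y′⊑y x′ px′ y′~x′ with graded x x′ px px′
    ... | inj₁ x⊑x′ = adj-sym G (x⊑x′ y py (adj-sym G y~x))
    ... | inj₂ x′⊑x = contradiction (adj-sym G (x′⊑x y′ py′ (adj-sym G y′~x′))) y′≁x

  largest : ∀ {A B} → Graded G part A B → {Q : Pred (Fin n) 0ℓ} → Decidable Q → (∀ {x} → Q x → part x ≡ A) →
            Σ (Fin n) Q → Σ[ m ∈ Fin n ] Q m × (∀ x → Q x → NbhdIncl G part B x m)
  largest graded Q? inA = greatest Q? (NbhdIncl G part _) (λ y py h → h) (λ r₁ r₂ y py h → r₂ y py (r₁ y py h))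
                                  (λ qx qy → graded _ _ (inA qx) (inA qy))

  smallest : ∀ {A B} → Graded G part A B → {Q : Pred (Fin n) 0ℓ} → Decidable Q → (∀ {x} → Q x → part x ≡ A) →
             Σ (Fin n) Q → Σ[ m ∈ Fin n ] Q m × (∀ x → Q x → NbhdIncl G part B m x)
  smallest graded Q? inA = greatest Q? (λ x y → NbhdIncl G part _ y x) (λ y py h → h) (λ r₁ r₂ y py h → r₁ y py (r₂ y py h))
                                   (λ qx qy → swap (graded _ _ (inA qx) (inA qy)))

  ∈-window-part : ∀ {i u a} → part u ≡ a → T (inWindow i a) → u ∈ window i
  ∈-window-part {i} pu≡a h = ∈-window⁺ (subst (T ∘ inWindow i) (sym pu≡a) h)

  apart-parts : ∀ {u w a b} → part u ≡ a → part w ≡ b → T (Apart a b) → ¬ Adj G u w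
  apart-parts refl refl = apart-nonadj

  dominates : ∀ {i s X} → part s ≡ X → (∀ b → ¬ GradedIn i X b) → (∀ b → ¬ GradedIn i b X) →
              s ∈ window i → ∀ u → u ∈ window i → u ≢ s → Adj G s u
  dominates refl out₁ out₂ s∈W u u∈W u≢s with window-adjacent s∈W u∈W (u≢s ∘ sym)
  ... | inj₁ s~u = s~u
  ... | inj₂ (inj₁ g) = contradiction g (out₁ _)
  ... | inj₂ (inj₂ g) = contradiction g (out₂ _)

  PairOf : Window → Part → Part → Set
  PairOf i A B = ∀ {a b} → GradedIn i a b → (a ≡ A × b ≡ B) ⊎ (a ≡ B × b ≡ A)

  adjacent-except : ∀ {i s A B} → PairOf i A B → A ≢ B → part s ≡ A → s ∈ window i →
                    ∀ u → u ∈ window i → u ≢ s → part u ≢ B → Adj G s u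
  adjacent-except pair A≢B refl s∈W u u∈W u≢s pu≢B with window-adjacent s∈W u∈W (u≢s ∘ sym)
  ... | inj₁ s~u = s~u
  ... | inj₂ (inj₁ g) with pair g
  ... | inj₁ (_ , pu≡B) = contradiction pu≡B pu≢B
  ... | inj₂ (ps≡B , _) = contradiction ps≡B A≢B
  adjacent-except pair A≢B refl s∈W u u∈W u≢s pu≢B | inj₂ (inj₂ g) with pair g
  ... | inj₁ (_ , ps≡B) = contradiction ps≡B A≢B
  ... | inj₂ (pu≡B , _) = contradiction pu≡B pu≢B

  -- Two vertices x ∈ A and y ∈ B of S, where {A,B} is the graded pair of window i
  -- and x has the largest B-neighbourhood among the A-vertices of U non-adjacent
  -- to y, hit window i: a clique with an A-vertex non-adjacent to y is dominated
  -- by x, any other clique by y.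
  pair-hits : ∀ {U S i A B x y} → PairOf i A B → A ≢ B → x ∈ S → y ∈ S → x ∈ window i → y ∈ window i →
              part x ≡ A → part y ≡ B → (∀ x′ → x′ ∈ U → part x′ ≡ A → ¬ Adj G x′ y → NbhdIncl G part B x′ x) →
              Hits U S i
  pair-hits {U} {S} {i} {A} {B} {x} {y} pair A≢B x∈S y∈S x∈W y∈W px py best K (clique , K⊆U─S , K⊆W)
    with Fin.any? (λ u → u ∈? K ×-dec part u ≟P A ×-dec ¬? (adj? G u y))
  ... | yes (u , u∈K , pu , u≁y) = x , x∈S , x∈W , x~K
    where
    x~K : ∀ w → w ∈ K → Adj G x w
    x~K w w∈K with part w ≟P B
    ... | yes pw = best u (p─q⊆p U S (K⊆U─S u∈K)) pu u≁y w pw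
                     (clique u w u∈K w∈K (λ u≡w → A≢B (trans (sym pu) (trans (cong part u≡w) pw))))
    ... | no pw≢B = adjacent-except pair A≢B px x∈W w (K⊆W w∈K) (avoiding K⊆U─S x∈S w∈K) pw≢B
  ... | no none = y , y∈S , y∈W , y~K
    where
    y~K : ∀ w → w ∈ K → Adj G y w
    y~K w w∈K with part w ≟P A
    ... | yes pw = adj-sym G (decidable-stable (adj? G w y) (λ w≁y → none (w , w∈K , pw , w≁y)))
    ... | no pw≢A = adjacent-except (swap ∘ pair) (A≢B ∘ sym) py y∈W w (K⊆W w∈K) (avoiding K⊆U─S y∈S w∈K) pw≢A

  hub-adjacent : ∀ {U i A B h K} → PairOf i A B → A ≢ B → part h ≡ A → h ∈ window i →
                 (∀ x → x ∈ U → part x ≡ A → NbhdIncl G part B x h) →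
                 IsClique G K → K ⊆ U → K ⊆ window i → h ∉ K → (Σ[ u ∈ Fin n ] u ∈ K × part u ≡ A) →
                 ∀ w → w ∈ K → Adj G h w
  hub-adjacent pair A≢B ph h∈W hub clique K⊆U K⊆W h∉K (u , u∈K , pu) w w∈K with part w ≟P _
  ... | yes pw = hub u (K⊆U u∈K) pu w pw (clique u w u∈K w∈K (λ u≡w → A≢B (trans (sym pu) (trans (cong part u≡w) pw))))
  ... | no pw≢B = adjacent-except pair A≢B ph h∈W w (K⊆W w∈K) (λ w≡h → h∉K (subst (_∈ _) w≡h w∈K)) pw≢B

  hub-bound : ∀ {U S i b A B h K} → CliqueBound U i b → S ⊆ U → PairOf i A B → A ≢ B →
              h ∈ S → part h ≡ A → h ∈ window i → (∀ x → x ∈ U → part x ≡ A → NbhdIncl G part B x h) →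
              CliqueIn (U ─ S) i K → (Σ[ u ∈ Fin n ] u ∈ K × part u ≡ A) → suc ∣ K ∣ ≤ b
  hub-bound {U} {S} bound S⊆U pair A≢B h∈S ph h∈W hub c@(clique , K⊆U─S , K⊆W) hasA =
    extension-bound bound (clique-⊆ (p─q⊆p U S) c) (S⊆U h∈S) h∈W h∉K
      (hub-adjacent pair A≢B ph h∈W hub clique (p─q⊆p U S ∘ K⊆U─S) K⊆W h∉K hasA)
    where
    h∉K = λ h∈K → avoiding K⊆U─S h∈S h∈K refl

  dominating-hits : ∀ {U S i s X} → part s ≡ X → (∀ b → ¬ GradedIn i X b) → (∀ b → ¬ GradedIn i b X) →
                    s ∈ S → s ∈ window i → Hits U S i
  dominating-hits ps out₁ out₂ s∈S s∈W = dominant-hits s∈S s∈W (λ u _ → dominates ps out₁ out₂ s∈W u)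

  shift-window : ∀ {i j u} X → (∀ a → T (not (inWindow i a) ∨ ⌊ a ≟P X ⌋ ∨ inWindow j a)) →
                 u ∈ window i → part u ≢ X → u ∈ window j
  shift-window {i} {j} {u} X fact u∈W pu≢X with ∨-cases (not (inWindow i (part u))) (fact (part u))
  ... | inj₁ u∉W = contradiction (∈-window⁻ u∈W) (not-T _ u∉W)
  ... | inj₂ h with ∨-cases ⌊ part u ≟P X ⌋ h
  ... | inj₁ pu≡X = contradiction (toWitness pu≡X) pu≢X
  ... | inj₂ u∈Wj = ∈-window⁺ u∈Wj

  own-zone : ∀ i → T (zoneIn i i)
  own-zone 0F = tt
  own-zone 1F = tt
  own-zone 2F = tt
  own-zone 3F = tt
  own-zone 4F = tt

  zone-0 : ∀ {a} → zone a ≡ 0F → a ≡ Q5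
  zone-0 {Q5} _ = refl
  zone-0 {Q1} ()
  zone-0 {Q2} ()
  zone-0 {Q3} ()
  zone-0 {Q4} ()
  zone-0 {R2} ()
  zone-0 {R3} ()

  zone-1 : ∀ {a} → zone a ≡ 1F → a ≡ Q1
  zone-1 {Q1} _ = refl
  zone-1 {Q2} ()
  zone-1 {Q3} ()
  zone-1 {Q4} ()
  zone-1 {Q5} ()
  zone-1 {R2} ()
  zone-1 {R3} ()

  zone-4 : ∀ {a} → zone a ≡ 4F → a ≡ Q4
  zone-4 {Q4} _ = refl
  zone-4 {Q1} ()
  zone-4 {Q2} ()
  zone-4 {Q3} ()
  zone-4 {Q5} ()
  zone-4 {R2} ()
  zone-4 {R3} ()

  ZoneVertex : Subset n → Window → Set
  ZoneVertex U z = Σ[ v ∈ Fin n ] v ∈ U × zone (part v) ≡ z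

  zone-vertex? : ∀ U z → Dec (ZoneVertex U z)
  zone-vertex? U z = Fin.any? (λ v → v ∈? U ×-dec zone (part v) ≟ z)

  vacant : ∀ {U z} → ¬ ZoneVertex U z → ∀ v → v ∈ U → zone (part v) ≢ z
  vacant none v v∈U zv = none (v , v∈U , zv)

  Minimal : Subset n → Window → Fin n → Set
  Minimal U i v = ∀ u w → u ∈ U → GradedIn i (part u) (part w) → Adj G v w → Adj G u w

  minimal-at : ∀ U i X Y → Graded G part X Y → zone X ≡ i → (∀ {a b} → GradedIn i a b → a ≡ X × b ≡ Y) →
               ZoneVertex U i → Σ[ v ∈ Fin n ] (v ∈ U × zone (part v) ≡ i) × Minimal U i v
  minimal-at U i X Y graded zX pair (v , v∈U , zv) with Fin.any? (λ u → u ∈? U ×-dec part u ≟P X)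
  ... | no none = v , (v∈U , zv) , λ u w u∈U g _ → contradiction (u , u∈U , proj₁ (pair g)) none
  ... | yes someX with smallest graded (λ u → u ∈? U ×-dec part u ≟P X) proj₂ someX
  ... | m , (m∈U , pm) , below =
    m , (m∈U , trans (cong zone pm) zX) , λ u w u∈U g m~w → below u (u∈U , proj₁ (pair g)) w (proj₂ (pair g)) m~w

  minimal-vertex : ∀ U i → ZoneVertex U i → Σ[ v ∈ Fin n ] (v ∈ U × zone (part v) ≡ i) × Minimal U i v
  minimal-vertex U 0F (v , h) = v , h , λ _ _ _ ()
  minimal-vertex U 1F = minimal-at U 1F Q1 Q2 g-Q1-Q2 refl (λ g → g)
  minimal-vertex U 2F = minimal-at U 2F R2 R3 g-R2-R3 refl (λ g → g)
  minimal-vertex U 3F = minimal-at U 3F Q3 Q4 g-Q3-Q4 refl (λ g → g)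
  minimal-vertex U 4F (v , h) = v , h , λ _ _ _ ()

  -- If zone i-1 is empty in U, a minimal vertex v of zone i is simplicial in
  -- window i: its neighbours avoid the zones apart from it and zone i-1, so they
  -- lie in window i, where two of them are adjacent unless they form the graded
  -- pair, and then minimality of v applies.
  gap : ∀ U i → (∀ u → u ∈ U → zone (part u) ≢ prev i) → ZoneVertex U i → Simplicial U
  gap U i empty-before z with minimal-vertex U i z
  ... | v , (v∈U , zv) , minimal = record
    { vertex = v ; win = i ; ∈U = v∈U ; ∈W = zone-∈-window zv (own-zone i)
    ; nbrs-in = nbrs-in ; nbrs-adjacent = nbrs-adjacent }
    where
    nbrs-in : ∀ u → u ∈ U → Adj G v u → u ∈ window i
    nbrs-in u u∈U v~u with ∨-cases (Apart (part v) (part u)) (neighbour-zones (part v) (part u))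
    ... | inj₁ apart = contradiction v~u (apart-nonadj apart)
    ... | inj₂ h with ∨-cases ⌊ zone (part u) ≟ prev (zone (part v)) ⌋ h
    ... | inj₁ before = contradiction (trans (toWitness before) (cong prev zv)) (empty-before u u∈U)
    ... | inj₂ in-window = ∈-window⁺ (subst (λ z → T (inWindow z (part u))) zv in-window)
    nbrs-adjacent : ∀ u w → u ∈ U → w ∈ U → Adj G v u → Adj G v w → u ≢ w → Adj G u w
    nbrs-adjacent u w u∈U w∈U v~u v~w u≢w with window-adjacent (nbrs-in u u∈U v~u) (nbrs-in w w∈U v~w) u≢w
    ... | inj₁ u~w = u~w
    ... | inj₂ (inj₁ g) = minimal u w u∈U g v~w
    ... | inj₂ (inj₂ g) = adj-sym G (minimal w u w∈U g v~u)

  -- Take x₁, the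
  -- Q1-non-neighbour of q₂ with the largest Q2-neighbourhood, and q₄, the
  -- Q4-vertex with the largest Q3-neighbourhood; S = {x₁, q₂, q₄} hits windows
  -- 0, 1, 2, 4.  A clique of window 3 avoiding S is extended by q₄ if it has a
  -- Q4-vertex, and otherwise lies in window 2, where q₂ extends it.
  peel-Γ : ∀ {U p} → Bounded U p → ∀ x₀ q₂ → x₀ ∈ U → q₂ ∈ U → part x₀ ≡ Q1 → part q₂ ≡ Q2 →
           ¬ Adj G x₀ q₂ → ZoneVertex U 4F → Peel U p
  peel-Γ {U} {p} bnd x₀ q₂ x₀∈U q₂∈U px₀ pq₂ x₀≁q₂ (y₀ , y₀∈U , zy₀)
    with largest g-Q1-Q2 (λ x → (x ∈? U ×-dec part x ≟P Q1) ×-dec ¬? (adj? G x q₂)) (proj₂ ∘ proj₁)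
                 (x₀ , (x₀∈U , px₀) , x₀≁q₂)
       | largest (graded-sym g-Q3-Q4) (λ x → x ∈? U ×-dec part x ≟P Q4) proj₂ (y₀ , y₀∈U , zone-4 zy₀)
  ... | x₁ , ((x₁∈U , px₁) , x₁≁q₂) , x₁-best | q₄ , (q₄∈U , pq₄) , q₄-hub =
    peel bnd S S⊆U (stable-triple x₁≁q₂ (apart-parts px₁ pq₄ tt) (apart-parts pq₂ pq₄ tt)) 3F hits small
    where
    S = ⁅ x₁ ⁆ ∪ (⁅ q₂ ⁆ ∪ ⁅ q₄ ⁆)
    S⊆U = ⁅⁆∪-⊆ x₁∈U (⁅⁆∪-⊆ q₂∈U (⁅⁆-⊆ q₄∈U))
    x₁∈S : x₁ ∈ S
    x₁∈S = ∈⁅⁆∪-here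
    q₂∈S : q₂ ∈ S
    q₂∈S = ∈⁅⁆∪-there ∈⁅⁆∪-here
    q₄∈S : q₄ ∈ S
    q₄∈S = ∈⁅⁆∪-there (∈⁅⁆∪-there (x∈⁅x⁆ q₄))
    hits₂ : Hits U S 2F
    hits₂ = dominating-hits pq₂ (λ _ → λ { (() , _) }) (λ _ → λ { (_ , ()) }) q₂∈S (∈-window-part pq₂ tt)
    hits : ∀ i → i ≢ 3F → Hits U S i
    hits 0F _ = dominating-hits px₁ (λ _ ()) (λ _ ()) x₁∈S (∈-window-part px₁ tt)
    hits 1F _ = pair-hits inj₁ (λ ()) x₁∈S q₂∈S (∈-window-part px₁ tt) (∈-window-part pq₂ tt) px₁ pq₂
                  (λ x x∈U px x≁q₂ → x₁-best x ((x∈U , px) , x≁q₂))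
    hits 2F _ = hits₂
    hits 3F 3≢3 = contradiction refl 3≢3
    hits 4F _ = dominating-hits pq₄ (λ _ ()) (λ _ ()) q₄∈S (∈-window-part pq₄ tt)
    small : ∀ K → CliqueIn (U ─ S) 3F K → ∣ K ∣ < Φ p
    small K c@(clique , K⊆U─S , K⊆W) with Fin.any? (λ u → u ∈? K ×-dec part u ≟P Q4)
    ... | yes hasQ4 = ≤-trans (hub-bound (bnd 3F) S⊆U inj₂ (λ ()) q₄∈S pq₄ (∈-window-part pq₄ tt)
                                 (λ x x∈U px → q₄-hub x (x∈U , px)) c hasQ4)
                      (load≤Φ p 3F)
    ... | no noQ4 = ≤-trans (hits-bound S⊆U (bnd 2F) hits₂
                      (clique , K⊆U─S , λ {u} u∈K → shift-window Q4 window3-without-Q4 (K⊆W u∈K) (λ pu → noQ4 (u , u∈K , pu))))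
                      (load≤Φ p 2F)

  -- Take x₄, the Q4-non-neighbour of q₃ with the largest
  -- Q3-neighbourhood, and q₁, the Q1-vertex with the largest Q2-neighbourhood;
  -- S = {q₁, q₃, x₄} hits windows 0, 2, 3, 4, and window 1 is capped by q₁ and q₃.
  peel-Γ′ : ∀ {U p} → Bounded U p → ∀ q₃ y₀ → q₃ ∈ U → y₀ ∈ U → part q₃ ≡ Q3 → part y₀ ≡ Q4 →
            ¬ Adj G q₃ y₀ → ZoneVertex U 1F → Peel U p
  peel-Γ′ {U} {p} bnd q₃ y₀ q₃∈U y₀∈U pq₃ py₀ q₃≁y₀ (x₀ , x₀∈U , zx₀)
    with largest (graded-sym g-Q3-Q4) (λ x → (x ∈? U ×-dec part x ≟P Q4) ×-dec ¬? (adj? G x q₃)) (proj₂ ∘ proj₁)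
                 (y₀ , (y₀∈U , py₀) , q₃≁y₀ ∘ adj-sym G)
       | largest g-Q1-Q2 (λ x → x ∈? U ×-dec part x ≟P Q1) proj₂ (x₀ , x₀∈U , zone-1 zx₀)
  ... | x₄ , ((x₄∈U , px₄) , x₄≁q₃) , x₄-best | q₁ , (q₁∈U , pq₁) , q₁-hub =
    peel bnd S S⊆U (stable-triple (apart-parts pq₁ pq₃ tt) (apart-parts pq₁ px₄ tt) (x₄≁q₃ ∘ adj-sym G)) 1F hits small
    where
    S = ⁅ q₁ ⁆ ∪ (⁅ q₃ ⁆ ∪ ⁅ x₄ ⁆)
    S⊆U = ⁅⁆∪-⊆ q₁∈U (⁅⁆∪-⊆ q₃∈U (⁅⁆-⊆ x₄∈U))
    q₁∈S : q₁ ∈ S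
    q₁∈S = ∈⁅⁆∪-here
    q₃∈S : q₃ ∈ S
    q₃∈S = ∈⁅⁆∪-there ∈⁅⁆∪-here
    x₄∈S : x₄ ∈ S
    x₄∈S = ∈⁅⁆∪-there (∈⁅⁆∪-there (x∈⁅x⁆ x₄))
    hits₂ : Hits U S 2F
    hits₂ = dominating-hits pq₃ (λ _ → λ { (() , _) }) (λ _ → λ { (_ , ()) }) q₃∈S (∈-window-part pq₃ tt)
    hits : ∀ i → i ≢ 1F → Hits U S i
    hits 0F _ = dominating-hits pq₁ (λ _ ()) (λ _ ()) q₁∈S (∈-window-part pq₁ tt)
    hits 1F 1≢1 = contradiction refl 1≢1
    hits 2F _ = hits₂
    hits 3F _ = pair-hits inj₂ (λ ()) x₄∈S q₃∈S (∈-window-part px₄ tt) (∈-window-part pq₃ tt) px₄ pq₃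
                  (λ x x∈U px x≁q₃ → x₄-best x ((x∈U , px) , x≁q₃))
    hits 4F _ = dominating-hits px₄ (λ _ ()) (λ _ ()) x₄∈S (∈-window-part px₄ tt)
    small : ∀ K → CliqueIn (U ─ S) 1F K → ∣ K ∣ < Φ p
    small K c@(clique , K⊆U─S , K⊆W) with Fin.any? (λ u → u ∈? K ×-dec part u ≟P Q1)
    ... | yes hasQ1 = ≤-trans (hub-bound (bnd 1F) S⊆U inj₁ (λ ()) q₁∈S pq₁ (∈-window-part pq₁ tt)
                                 (λ x x∈U px → q₁-hub x (x∈U , px)) c hasQ1)
                      (load≤Φ p 1F)
    ... | no noQ1 = ≤-trans (hits-bound S⊆U (bnd 2F) hits₂
                      (clique , K⊆U─S , λ {u} u∈K → shift-window Q1 window1-without-Q1 (K⊆W u∈K) (λ pu → noQ1 (u , u∈K , pu))))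
                      (load≤Φ p 2F)

  -- Take r₂, the
  -- R2-non-neighbour of r₃ with the largest R3-neighbourhood, and a Q5-vertex
  -- q₅; S = {q₅, r₂, r₃} hits all five windows.
  peel-α : ∀ {U p} → Bounded U p → ∀ r₂₀ r₃ → r₂₀ ∈ U → r₃ ∈ U → part r₂₀ ≡ R2 → part r₃ ≡ R3 →
           ¬ Adj G r₂₀ r₃ → ZoneVertex U 0F → Peel U p
  peel-α {U} {p} bnd r₂₀ r₃ r₂₀∈U r₃∈U pr₂₀ pr₃ r₂₀≁r₃ (q₅ , q₅∈U , zq₅)
    with largest g-R2-R3 (λ x → (x ∈? U ×-dec part x ≟P R2) ×-dec ¬? (adj? G x r₃)) (proj₂ ∘ proj₁)
                 (r₂₀ , (r₂₀∈U , pr₂₀) , r₂₀≁r₃)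
  ... | r₂ , ((r₂∈U , pr₂) , r₂≁r₃) , r₂-best =
    peel bnd S S⊆U (stable-triple (apart-parts pq₅ pr₂ tt) (apart-parts pq₅ pr₃ tt) r₂≁r₃) 0F hits small
    where
    pq₅ = zone-0 zq₅
    S = ⁅ q₅ ⁆ ∪ (⁅ r₂ ⁆ ∪ ⁅ r₃ ⁆)
    S⊆U = ⁅⁆∪-⊆ q₅∈U (⁅⁆∪-⊆ r₂∈U (⁅⁆-⊆ r₃∈U))
    q₅∈S : q₅ ∈ S
    q₅∈S = ∈⁅⁆∪-here
    r₂∈S : r₂ ∈ S
    r₂∈S = ∈⁅⁆∪-there ∈⁅⁆∪-here
    r₃∈S : r₃ ∈ S
    r₃∈S = ∈⁅⁆∪-there (∈⁅⁆∪-there (x∈⁅x⁆ r₃))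
    hits₀ : Hits U S 0F
    hits₀ = dominating-hits pq₅ (λ _ ()) (λ _ ()) q₅∈S (∈-window-part pq₅ tt)
    hits : ∀ i → i ≢ 0F → Hits U S i
    hits 0F 0≢0 = contradiction refl 0≢0
    hits 1F _ = dominating-hits pr₂ (λ _ → λ { (() , _) }) (λ _ → λ { (_ , ()) }) r₂∈S (∈-window-part pr₂ tt)
    hits 2F _ = pair-hits inj₁ (λ ()) r₂∈S r₃∈S (∈-window-part pr₂ tt) (∈-window-part pr₃ tt) pr₂ pr₃
                  (λ x x∈U px x≁r₃ → r₂-best x ((x∈U , px) , x≁r₃))
    hits 3F _ = dominating-hits pr₃ (λ _ → λ { (() , _) }) (λ _ → λ { (_ , ()) }) r₃∈S (∈-window-part pr₃ tt)
    hits 4F _ = dominating-hits pq₅ (λ _ ()) (λ _ ()) q₅∈S (∈-window-part pq₅ tt)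
    small : ∀ K → CliqueIn (U ─ S) 0F K → ∣ K ∣ < Φ p
    small K c = ≤-trans (hits-bound S⊆U (bnd 0F) hits₀ c) (load≤Φ p 0F)

  -- If the graded pairs are complete in U, every window of U is a clique.
  -- Avoiding a light window j, a vertex a of zone j+2 and a vertex b of zone
  -- j+4 are non-adjacent and together meet every other window.
  peel-complete : ∀ {U p} → Bounded U p → (∀ i u w → u ∈ U → w ∈ U → GradedIn i (part u) (part w) → Adj G u w) →
                  (∀ z → ZoneVertex U z) → Peel U p
  peel-complete {U} {p} bnd complete rep with light-window p Φ-positive
    where
    Φ-positive : 0 < Φ p
    Φ-positive with rep 0F
    ... | v , v∈U , zv = ≤-trans (vertex-load bnd v∈U (zone-∈-window zv tt)) (load≤Φ p 0F)
  ... | j , light with rep (next (next j)) | rep (next (next (next (next j))))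
  ... | a , a∈U , za | b , b∈U , zb =
    peel bnd (⁅ a ⁆ ∪ ⁅ b ⁆) (⁅⁆∪-⊆ a∈U (⁅⁆-⊆ b∈U)) (stable-pair a≁b) j hits small
    where
    a≁b : ¬ Adj G a b
    a≁b with ∨-cases (not ⌊ zone (part b) ≟ next (next (zone (part a))) ⌋) (two-zones-apart (part a) (part b))
    ... | inj₁ far = contradiction (fromWitness (trans zb (cong (next ∘ next) (sym za)))) (not-T _ far)
    ... | inj₂ apart = apart-nonadj apart
    window-hits : ∀ {i s} → s ∈ ⁅ a ⁆ ∪ ⁅ b ⁆ → s ∈ window i → Hits U (⁅ a ⁆ ∪ ⁅ b ⁆) i
    window-hits {i} {s} s∈S s∈W = dominant-hits s∈S s∈W s~W
      where
      s~W : ∀ u → u ∈ U → u ∈ window i → u ≢ s → Adj G s u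
      s~W u u∈U u∈W u≢s with window-adjacent s∈W u∈W (u≢s ∘ sym)
      ... | inj₁ s~u = s~u
      ... | inj₂ (inj₁ g) = complete i s u (⁅⁆∪-⊆ a∈U (⁅⁆-⊆ b∈U) s∈S) u∈U g
      ... | inj₂ (inj₂ g) = adj-sym G (complete i u s u∈U (⁅⁆∪-⊆ a∈U (⁅⁆-⊆ b∈U) s∈S) g)
    hits : ∀ i → i ≢ j → Hits U (⁅ a ⁆ ∪ ⁅ b ⁆) i
    hits i i≢j with ∨-cases ⌊ i ≟ j ⌋ (windows-covered i j)
    ... | inj₁ i≡j = contradiction (toWitness i≡j) i≢j
    ... | inj₂ h with ∨-cases (zoneIn i (next (next j))) h
    ... | inj₁ a-zone = window-hits ∈⁅⁆∪-here (zone-∈-window za a-zone)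
    ... | inj₂ b-zone = window-hits (∈⁅⁆∪-there (x∈⁅x⁆ b)) (zone-∈-window zb b-zone)
    small : ∀ K → CliqueIn (U ─ (⁅ a ⁆ ∪ ⁅ b ⁆)) j K → ∣ K ∣ < Φ p
    small K c = ≤-<-trans (bnd j K (clique-⊆ (p─q⊆p U _) c)) light

  Crossing : Subset n → Window → Set
  Crossing U i = Σ[ u ∈ Fin n ] Σ[ w ∈ Fin n ] u ∈ U × w ∈ U × GradedIn i (part u) (part w) × ¬ Adj G u w

  crossing? : ∀ U i → Dec (Crossing U i)
  crossing? U i = Fin.any? λ u → Fin.any? λ w →
    u ∈? U ×-dec w ∈? U ×-dec gradedIn? i (part u) (part w) ×-dec ¬? (adj? G u w)

  peel-full : ∀ {U p} → Bounded U p → (∀ z → ZoneVertex U z) → Peel U p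
  peel-full {U} bnd rep with Fin.any? (crossing? U)
  ... | yes (1F , u , w , u∈U , w∈U , (pu , pw) , u≁w) = peel-Γ bnd u w u∈U w∈U pu pw u≁w (rep 4F)
  ... | yes (2F , u , w , u∈U , w∈U , (pu , pw) , u≁w) = peel-α bnd u w u∈U w∈U pu pw u≁w (rep 0F)
  ... | yes (3F , u , w , u∈U , w∈U , (pu , pw) , u≁w) = peel-Γ′ bnd u w u∈U w∈U pu pw u≁w (rep 1F)
  ... | no none = peel-complete bnd
          (λ i u w u∈U w∈U g → decidable-stable (adj? G u w) (λ u≁w → none (i , u , w , u∈U , w∈U , g , u≁w))) rep

  reduce : Reduction
  reduce U p bnd (u , u∈U)
    with zone-vertex? U 0F | zone-vertex? U 1F | zone-vertex? U 2F | zone-vertex? U 3F | zone-vertex? U 4F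
  ... | yes r₀ | yes r₁ | yes r₂ | yes r₃ | yes r₄ =
    inj₂ (peel-full bnd λ { 0F → r₀ ; 1F → r₁ ; 2F → r₂ ; 3F → r₃ ; 4F → r₄ })
  ... | no e₀ | yes r₁ | _ | _ | _ = inj₁ (gap U 1F (vacant e₀) r₁)
  ... | _ | no e₁ | yes r₂ | _ | _ = inj₁ (gap U 2F (vacant e₁) r₂)
  ... | _ | _ | no e₂ | yes r₃ | _ = inj₁ (gap U 3F (vacant e₂) r₃)
  ... | _ | _ | _ | no e₃ | yes r₄ = inj₁ (gap U 4F (vacant e₃) r₄)
  ... | yes r₀ | _ | _ | _ | no e₄ = inj₁ (gap U 0F (vacant e₄) r₀)
  ... | no e₀ | no e₁ | no e₂ | no e₃ | no e₄ = contradiction refl (unzoned (zone (part u)))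
    where
    unzoned : ∀ z → zone (part u) ≢ z
    unzoned 0F = vacant e₀ u u∈U
    unzoned 1F = vacant e₁ u u∈U
    unzoned 2F = vacant e₂ u u∈U
    unzoned 3F = vacant e₃ u u∈U
    unzoned 4F = vacant e₄ u u∈U

-- Every clique of G has at most ω vertices, so the uniform load ω bounds all
-- windows of the whole vertex set; the engine, run with the band strategy,
-- colours G with Φ ω ≤ ⌈5ω/4⌉ colours.
theorem5p13 : ∀ (n : ℕ) (G : Graph n) → IsBand G →
    ∀ (w : ℕ) → IsCliqueNumber G w → Colorable G (ceil5/4 w)
theorem5p13 n G (part , band) w (_ , clique≤w) =
  colorable (colouring-mono (Φ-uniform w) (colour reduce ⊤ (λ _ → w) (λ i K (clique , _) → clique≤w K clique)))
  where
  open Band G part band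
  open Peeling G window
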